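{- Let $G_2$ be a finite graph and let $G_1$ be a graph which is a proper subgraph of $G_2$ (i.e. $V_{G_1}\subseteq V_{G_2}$, $E_{G_1}\subseteq E_{G_2}$, and $G_1\neq G_2$). Then $C^0_{G_1}<C^0_{G_2}$.
   Context: A graph is a locally finite, undirected, connected, simple graph $G$ with vertex set $V_G$ and edge set $E_G$, with path distance $d_G$ and closed balls $B(v,r)=\{w: d_G(v,w)\le r\}$. A measure on $G$ is a function $\mu:V_G\to(0,\infty)$, $\mu(A)=\sum_{v\in A}\mu(v)$. For a measure $\mu$, $C^0_\mu=\sup_{v\in V_G}\mu(B(v,1))/\mu(\{v\})$, and $C^0_G=\inf_\mu C^0_\mu$ over all doubling measures $\mu$ on $G$ (for finite graphs every measure is doubling).
   Formalization: Measures on $G_1$ and $G_2$ take positive rational values rather than values in $(0,\infty)$, and $C^0_{G_1}<C^0_{G_2}$ is stated through a rational number lying between the two infima. -}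

module Defs where

open import Data.Nat using (ℕ; zero; suc)
open import Data.Fin using (Fin; zero; suc)
open import Data.Bool using (Bool; true; false; if_then_else_)
open import Data.Product using (Σ; ∃; _×_; _,_)
open import Data.Sum using (_⊎_)
open import Data.Rational using (ℚ; 0ℚ; _+_; _*_; _<_; _≤_)
open import Relation.Binary.PropositionalEquality using (_≡_)
open import Relation.Nullary using (¬_)
open import Function.Definitions using (Injective)

record Graph (n : ℕ) : Set where
  field
    adj    : Fin n → Fin n → Bool
    sym    : ∀ u v → adj u v ≡ adj v u
    irrefl : ∀ v → adj v v ≡ false
open Graph public

data Reach {n : ℕ} (G : Graph n) : Fin n → Fin n → Set where
  here : ∀ {v} → Reach G v v
  step : ∀ {u w v} → adj G u w ≡ true → Reach G w v → Reach G u v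

Connected : {n : ℕ} → Graph n → Set
Connected G = ∀ u v → Reach G u v

sumFin : (n : ℕ) → (Fin n → ℚ) → ℚ
sumFin zero    f = 0ℚ
sumFin (suc n) f = f zero + sumFin n (λ i → f (suc i))

Measure : {n : ℕ} → Graph n → Set
Measure {n} G = Σ (Fin n → ℚ) (λ μ → ∀ v → 0ℚ < μ v)

-- μ(B(v,1)) = μ(v) + Σ_{w ~ v} μ(w).
ballMass : {n : ℕ} (G : Graph n) → (Fin n → ℚ) → Fin n → ℚ
ballMass {n} G μ v = μ v + sumFin n (λ w → if adj G v w then μ w else 0ℚ)

-- "C^0_G < q" : some measure μ has C^0_μ < q, i.e. μ(B(v,1)) < q μ(v) for all v
-- (C^0_μ is a maximum over the finitely many vertices).
C0-lt : {n : ℕ} → Graph n → ℚ → Set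
C0-lt {n} G q = Σ (Measure G) (λ { (μ , _) → ∀ v → ballMass G μ v < q * μ v })

-- "q ≤ C^0_G" : every measure μ has q ≤ C^0_μ, i.e. some vertex v has q μ(v) ≤ μ(B(v,1)).
C0-ge : {n : ℕ} → Graph n → ℚ → Set
C0-ge {n} G q = (m : Measure G) → let μ = Data.Product.proj₁ m in ∃ (λ v → q * μ v ≤ ballMass G μ v)

IsSubgraph : {m n : ℕ} → Graph m → Graph n → (Fin m → Fin n) → Set
IsSubgraph G1 G2 f = Injective _≡_ _≡_ f × (∀ u v → adj G1 u v ≡ true → adj G2 (f u) (f v) ≡ true)

-- G1 ≠ G2: either a vertex of G2 is missing or an edge of G2 between vertices of G1 is missing.
IsProper : {m n : ℕ} → Graph m → Graph n → (Fin m → Fin n) → Set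
IsProper G1 G2 f =
  ∃ (λ w → ∀ v → ¬ f v ≡ w)
  ⊎ ∃ (λ u → ∃ (λ v → adj G2 (f u) (f v) ≡ true × adj G1 u v ≡ false))

module Submission where

-- Write B = I + A for the matrix of a graph with loops added, so that μ(B(v,1)) = (Bμ)(v) and
-- "C⁰ < q" asks for a positive μ with Bμ < qμ. Put q = p/D. The truncated Neumann series
-- X = Σ_{k<N} q^{-k} Bᵏ1 satisfies BX − qX = q^{1−N}(Bᴺ1 − qᴺ), so if every vertex starts fewer
-- than qᴺ walks of length N in the graph with loops, X witnesses C⁰ < q; if every vertex starts at
-- least qᴺ of them, then BX ≥ qX, and since B is symmetric no μ with Bμ < qμ can exist:
-- Σ μ·qX ≤ Σ μ·BX = Σ X·Bμ < Σ X·qμ.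
-- So it suffices to separate walk counts. Transported into G₂, the matrix R of G₁ satisfies
-- R ≤ B₂ with one strict entry at the missing vertex or edge. As G₂ is connected, B₂ᴸ > 0
-- entrywise for some L, and routing through the strict entry gives Rᴷ < B₂ᴷ entrywise for
-- K = 2L + 1. Then (c + 1)Rᴷ ≤ c·B₂ᴷ for a large c, so walk counts of length jK differ by a factor
-- (1 + 1/c)ʲ, which exceeds any fixed bound. A ratio p/(2N + 1) whose N-th power lies in
-- (A, 2A + 1] then separates the walk counts.

open import Defs hiding (sym)
open import Data.Bool using (true; false; if_then_else_)
open import Data.Fin using (Fin; zero; suc; punchIn; punchOut)
import Data.Fin.Properties as Finₚ
open import Data.Nat.Base using (ℕ; suc)
import Data.Nat.Properties as ℕₚ
open import Data.Product using (∃; ∃₂; _×_; _,_; proj₁; proj₂)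
open import Data.Rational.Base using (ℚ)
open import Data.Sum using (inj₁; inj₂)
open import Function.Base using (_∘_)
open import Function.Definitions using (Injective)
open import Relation.Binary.PropositionalEquality
  using (_≡_; _≢_; refl; sym; trans; cong; cong₂; subst; subst₂; module ≡-Reasoning)
open import Relation.Nullary using (¬_; yes; no; contradiction)
open import Relation.Unary using (Decidable)

module _ where
  open import Data.List using (_∷_; [])
  open import Data.Nat
  open import Data.Nat.Properties
  open import Data.Nat.Tactic.RingSolver using (solve; solve-∀)
  open import Algebra.Properties.Semiring.Sum +-*-semiring
  import Algebra.Properties.CommutativeSemigroup *-commutativeSemigroup as *-CS

  *-mono-<-≤ : ∀ {a a′ b b′} → a < a′ → b ≤ b′ → 0 < b′ → a * b < a′ * b′
  *-mono-<-≤ {a} {a′} {b} {b′} a<a′ b≤b′ 0<b′ =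
    ≤-<-trans (*-monoʳ-≤ a b≤b′) (*-monoˡ-< b′ {{>-nonZero 0<b′}} a<a′)

  *-mono-≤-< : ∀ {a a′ b b′} → a ≤ a′ → b < b′ → 0 < a′ → a * b < a′ * b′
  *-mono-≤-< {a} {a′} {b} {b′} a≤a′ b<b′ 0<a′ =
    subst₂ _<_ (*-comm b a) (*-comm b′ a′) (*-mono-<-≤ b<b′ a≤a′ 0<a′)

  suc-*-≤-* : ∀ {a b c} → a < b → a ≤ c → suc c * a ≤ c * b
  suc-*-≤-* {a} {b} {c} a<b a≤c = begin
    a + c * a   ≤⟨ +-monoˡ-≤ (c * a) a≤c ⟩
    c + c * a   ≡⟨ *-suc c a ⟨
    c * suc a   ≤⟨ *-monoʳ-≤ c a<b ⟩
    c * b       ∎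
    where open ≤-Reasoning

  suc-2*-*-≤ : ∀ {B} c t → 0 < B → suc (2 * c) * t ≤ B → suc (2 * (c * t)) ≤ B
  suc-2*-*-≤ c zero    0<B _ rewrite *-zeroʳ c = 0<B
  suc-2*-*-≤ c (suc t) _ ≤B = ≤-trans (≤-trans (m≤m+n _ t) (≤-reflexive (expand c t))) ≤B
    where
    expand : ∀ c t → suc (2 * (c * suc t)) + t ≡ suc (2 * c) * suc t
    expand = solve-∀

  bernoulli : ∀ c j → c ^ j * (c + j) ≤ c * suc c ^ j
  bernoulli c zero    = ≤-reflexive (solve (c ∷ []))
  bernoulli c (suc j) = begin
    c * c ^ j * (c + suc j)               ≤⟨ m≤m+n _ (c ^ j * j) ⟩
    c * c ^ j * (c + suc j) + c ^ j * j   ≡⟨ expand c (c ^ j) j ⟩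
    suc c * (c ^ j * (c + j))             ≤⟨ *-monoʳ-≤ (suc c) (bernoulli c j) ⟩
    suc c * (c * suc c ^ j)               ≡⟨ *-CS.x∙yz≈y∙xz (suc c) c (suc c ^ j) ⟩
    c * suc c ^ suc j                     ∎
    where
    open ≤-Reasoning
    expand : ∀ c x j → c * x * (c + suc j) + x * j ≡ suc c * (x * (c + j))
    expand = solve-∀

  bernoulli-upper : ∀ p k → 2 * k ≤ p → p * suc p ^ k ≤ p ^ k * (p + 2 * k)
  bernoulli-upper p zero    _     = ≤-reflexive (solve (p ∷ []))
  bernoulli-upper p (suc k) 2k′≤p = begin
    p * (suc p * suc p ^ k)                          ≡⟨ *-CS.x∙yz≈y∙xz p (suc p) (suc p ^ k) ⟩
    suc p * (p * suc p ^ k)                          ≤⟨ *-monoʳ-≤ (suc p) (bernoulli-upper p k 2k≤p) ⟩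
    suc p * (p ^ k * (p + 2 * k))                    ≡⟨ expand p (p ^ k) k ⟩
    p ^ k * (p * (p + 2 * k) + p) + p ^ k * (2 * k)  ≤⟨ +-monoʳ-≤ _ (*-monoʳ-≤ (p ^ k) 2k≤p) ⟩
    p ^ k * (p * (p + 2 * k) + p) + p ^ k * p        ≡⟨ collect p (p ^ k) k ⟩
    p * p ^ k * (p + 2 * suc k)                      ∎
    where
    open ≤-Reasoning
    2k≤p : 2 * k ≤ p
    2k≤p = ≤-trans (*-monoʳ-≤ 2 (n≤1+n k)) 2k′≤p
    expand : ∀ p x k → suc p * (x * (p + 2 * k)) ≡ x * (p * (p + 2 * k) + p) + x * (2 * k)
    expand = solve-∀
    collect : ∀ p x k → x * (p * (p + 2 * k) + p) + x * p ≡ p * x * (p + 2 * suc k)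
    collect = solve-∀

  suc-^-≤-2*^ : ∀ p .{{_ : NonZero p}} k → 2 * k ≤ p → suc p ^ k ≤ 2 * p ^ k
  suc-^-≤-2*^ p k 2k≤p = *-cancelˡ-≤ p (begin
    p * suc p ^ k          ≤⟨ bernoulli-upper p k 2k≤p ⟩
    p ^ k * (p + 2 * k)    ≤⟨ *-monoʳ-≤ (p ^ k) (+-monoʳ-≤ p 2k≤p) ⟩
    p ^ k * (p + p)        ≡⟨ double p (p ^ k) ⟩
    p * (2 * p ^ k)        ∎)
    where
    open ≤-Reasoning
    double : ∀ p x → x * (p + p) ≡ p * (2 * x)
    double = solve-∀

  crossing : ∀ {Q : ℕ → Set} → Decidable Q → ¬ Q 0 → ∀ k → Q k → ∃ λ p → ¬ Q p × Q (suc p)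
  crossing Q? ¬Q0 zero    Q0   = contradiction Q0 ¬Q0
  crossing Q? ¬Q0 (suc k) Qk+1 with Q? k
  ... | yes Qk = crossing Q? ¬Q0 k Qk
  ... | no ¬Qk = k , ¬Qk , Qk+1

  -- With D = 2N + 1, take the last p with pᴺ ≤ A·Dᴺ. Either p + 1 ≤ D, or p ≥ 2N and the step
  -- from p to p + 1 at most doubles the N-th power; either way (p + 1)ᴺ ≤ (2A + 1)·Dᴺ.
  separating-ratio : ∀ A N → 0 < N →
                     ∃₂ λ p d → 0 < p × (∀ {r} → r ≤ A → suc d ^ N * r < p ^ N)
                                      × (∀ {r} → 2 * A < r → p ^ N ≤ suc d ^ N * r)
  separating-ratio A N@(suc N′) _ with crossing (λ p → B <? p ^ N) n≮0 (suc B) B<[1+B]^N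
    where
    B = A * suc (2 * N) ^ N
    B<[1+B]^N : B < suc B ^ N
    B<[1+B]^N = m≤m*n (suc B) (suc B ^ N′) {{m^n≢0 (suc B) N′}}
  ... | p , p^N≤B , B<[1+p]^N = suc p , 2 * N , z<s , below , above
    where
    D = suc (2 * N)
    upper : suc p ^ N ≤ suc (2 * A) * D ^ N
    upper with suc p ≤? 2 * N
    ... | yes 1+p≤2N = begin
      suc p ^ N              ≤⟨ ^-monoˡ-≤ N (m≤n⇒m≤1+n 1+p≤2N) ⟩
      D ^ N                  ≤⟨ m≤n*m (D ^ N) (suc (2 * A)) ⟩
      suc (2 * A) * D ^ N    ∎
      where open ≤-Reasoning
    ... | no 1+p≰2N = begin
      suc p ^ N              ≤⟨ suc-^-≤-2*^ p {{>-nonZero 0<p}} N 2N≤p ⟩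
      2 * p ^ N              ≤⟨ *-monoʳ-≤ 2 (≮⇒≥ p^N≤B) ⟩
      2 * (A * D ^ N)        ≡⟨ *-assoc 2 A (D ^ N) ⟨
      2 * A * D ^ N          ≤⟨ *-monoˡ-≤ (D ^ N) (n≤1+n (2 * A)) ⟩
      suc (2 * A) * D ^ N    ∎
      where
      open ≤-Reasoning
      2N≤p : 2 * N ≤ p
      2N≤p = ≤-pred (≰⇒> 1+p≰2N)
      0<p : 0 < p
      0<p = ≤-trans (s≤s z≤n) 2N≤p
    below : ∀ {r} → r ≤ A → D ^ N * r < suc p ^ N
    below {r} r≤A =
      ≤-<-trans (≤-trans (*-monoʳ-≤ (D ^ N) r≤A) (≤-reflexive (*-comm (D ^ N) A))) B<[1+p]^N
    above : ∀ {r} → 2 * A < r → suc p ^ N ≤ D ^ N * r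
    above {r} 2A<r = ≤-trans upper
      (≤-trans (≤-reflexive (*-comm (suc (2 * A)) (D ^ N))) (*-monoʳ-≤ (D ^ N) 2A<r))

  private
    sum-mono-≤ : ∀ {n} {f g : Fin n → ℕ} → (∀ i → f i ≤ g i) → sum f ≤ sum g
    sum-mono-≤ {zero}  f≤g = z≤n
    sum-mono-≤ {suc n} f≤g = +-mono-≤ (f≤g zero) (sum-mono-≤ (f≤g ∘ suc))

    ≤-sum : ∀ {n} (f : Fin n → ℕ) i → f i ≤ sum f
    ≤-sum f zero    = m≤m+n (f zero) _
    ≤-sum f (suc i) = ≤-trans (≤-sum (f ∘ suc) i) (m≤n+m _ (f zero))

    sum-mono-< : ∀ {n} {f g : Fin n → ℕ} → (∀ i → f i ≤ g i) → ∀ j → f j < g j → sum f < sum g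
    sum-mono-< f≤g zero    fj<gj = +-mono-<-≤ fj<gj (sum-mono-≤ (f≤g ∘ suc))
    sum-mono-< f≤g (suc j) fj<gj = +-mono-≤-< (f≤g zero) (sum-mono-< (f≤g ∘ suc) j fj<gj)

  sum-∘-injective-≤ : ∀ {k n} (g : Fin n → ℕ) {f : Fin k → Fin n} → Injective _≡_ _≡_ f →
                      sum (g ∘ f) ≤ sum g
  sum-∘-injective-≤ {zero}          g     f-inj = z≤n
  sum-∘-injective-≤ {suc k} {zero}  g {f} f-inj = contradiction (f zero) Finₚ.¬Fin0
  sum-∘-injective-≤ {suc k} {suc n} g {f} f-inj = begin
    g (f zero) + sum (g ∘ f ∘ suc)
      ≡⟨ cong (g (f zero) +_) (sum-cong-≗ (cong g ∘ sym ∘ Finₚ.punchIn-punchOut ∘ f₀≢)) ⟩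
    g (f zero) + sum (g ∘ punchIn (f zero) ∘ f′)
      ≤⟨ +-monoʳ-≤ (g (f zero)) (sum-∘-injective-≤ (g ∘ punchIn (f zero)) f′-inj) ⟩
    g (f zero) + sum (g ∘ punchIn (f zero))
      ≡⟨ sum-remove g ⟨
    sum g
      ∎
    where
    open ≤-Reasoning
    f₀≢ : ∀ u → f zero ≢ f (suc u)
    f₀≢ u = Finₚ.0≢1+n ∘ f-inj
    f′ : Fin k → Fin n
    f′ u = punchOut (f₀≢ u)
    f′-inj : Injective _≡_ _≡_ f′
    f′-inj {u} {v} eq = Finₚ.suc-injective (f-inj (Finₚ.punchOut-injective (f₀≢ u) (f₀≢ v) eq))

  Matrix : ℕ → Set
  Matrix n = Fin n → Fin n → ℕ

  I : ∀ {n} → Matrix n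
  I zero    zero    = 1
  I zero    (suc _) = 0
  I (suc _) zero    = 0
  I (suc x) (suc y) = I x y

  I-diag : ∀ {n} (x : Fin n) → I x x ≡ 1
  I-diag zero    = refl
  I-diag (suc x) = I-diag x

  I-≢ : ∀ {n} {x y : Fin n} → x ≢ y → I x y ≡ 0
  I-≢ {x = zero}  {zero}  x≢y = contradiction refl x≢y
  I-≢ {x = zero}  {suc y} x≢y = refl
  I-≢ {x = suc x} {zero}  x≢y = refl
  I-≢ {x = suc x} {suc y} x≢y = I-≢ (x≢y ∘ cong suc)

  I-≤-map : ∀ {k n} (f : Fin k → Fin n) u v → I u v ≤ I (f u) (f v)
  I-≤-map f u v with u Finₚ.≟ v
  ... | yes refl = ≤-reflexive (trans (I-diag u) (sym (I-diag (f u))))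
  ... | no u≢v rewrite I-≢ u≢v = z≤n

  infixr 8 _^ᴹ_
  infixl 7 _⊠_ _·_
  infix 4 _≤ᴹ_ _≗ᴹ_

  _·_ : ∀ {n} → Matrix n → (Fin n → ℕ) → Fin n → ℕ
  (M · g) x = sum (λ y → M x y * g y)

  _⊠_ : ∀ {n} → Matrix n → Matrix n → Matrix n
  (M ⊠ N) x z = (M · λ y → N y z) x

  _^ᴹ_ : ∀ {n} → Matrix n → ℕ → Matrix n
  M ^ᴹ zero  = I
  M ^ᴹ suc k = M ⊠ M ^ᴹ k

  _⊙_ : ∀ {n} → ℕ → Matrix n → Matrix n
  (α ⊙ M) x y = α * M x y

  rowSum : ∀ {n} → Matrix n → Fin n → ℕ
  rowSum M x = sum (M x)

  total : ∀ {n} → Matrix n → ℕ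
  total M = sum (rowSum M)

  _≤ᴹ_ : ∀ {n} → Matrix n → Matrix n → Set
  M ≤ᴹ N = ∀ x y → M x y ≤ N x y

  _≗ᴹ_ : ∀ {n} → Matrix n → Matrix n → Set
  M ≗ᴹ N = ∀ x y → M x y ≡ N x y

  ·-mono : ∀ {n} {M N : Matrix n} {g h : Fin n → ℕ} → M ≤ᴹ N → (∀ y → g y ≤ h y) →
           ∀ x → (M · g) x ≤ (N · h) x
  ·-mono M≤N g≤h x = sum-mono-≤ (λ y → *-mono-≤ (M≤N x y) (g≤h y))

  ·-linear : ∀ {n} (M : Matrix n) a (g : Fin n → ℕ) b h x →
             (M · λ y → a * g y + b * h y) x ≡ a * (M · g) x + b * (M · h) x
  ·-linear M a g b h x = begin
    sum (λ y → M x y * (a * g y + b * h y))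
      ≡⟨ sum-cong-≗ (λ y → distrib (M x y) (g y) (h y)) ⟩
    sum (λ y → a * (M x y * g y) + b * (M x y * h y))
      ≡⟨ ∑-distrib-+ (λ y → a * (M x y * g y)) (λ y → b * (M x y * h y)) ⟩
    sum (λ y → a * (M x y * g y)) + sum (λ y → b * (M x y * h y))
      ≡⟨ cong₂ _+_ (*-distribˡ-sum a (λ y → M x y * g y)) (*-distribˡ-sum b (λ y → M x y * h y)) ⟨
    a * (M · g) x + b * (M · h) x
      ∎
    where
    open ≡-Reasoning
    distrib : ∀ m u v → m * (a * u + b * v) ≡ a * (m * u) + b * (m * v)
    distrib m u v = solve (m ∷ a ∷ u ∷ b ∷ v ∷ [])

  ·-zeroʳ : ∀ {n} (M : Matrix n) x → (M · λ _ → 0) x ≡ 0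
  ·-zeroʳ {n} M x = trans (sum-cong-≗ (λ y → *-zeroʳ (M x y))) (sum-replicate-zero n)

  ·-I : ∀ {n} (g : Fin n → ℕ) x → (I · g) x ≡ g x
  ·-I {suc n} g zero = trans (cong₂ _+_ (+-identityʳ (g zero)) (sum-replicate-zero n)) (+-identityʳ (g zero))
  ·-I g (suc x)      = ·-I (g ∘ suc) x

  rowSum-cong : ∀ {n} {M N : Matrix n} → M ≗ᴹ N → ∀ x → rowSum M x ≡ rowSum N x
  rowSum-cong M≗N x = sum-cong-≗ (M≗N x)

  rowSum-I : ∀ {n} (x : Fin n) → rowSum I x ≡ 1
  rowSum-I x = trans (sum-cong-≗ (λ y → sym (*-identityʳ (I x y)))) (·-I (λ _ → 1) x)

  rowSum-⊠ : ∀ {n} (M N : Matrix n) x → rowSum (M ⊠ N) x ≡ (M · rowSum N) x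
  rowSum-⊠ M N x = begin
    sum (λ z → sum (λ y → M x y * N y z)) ≡⟨ ∑-comm (λ z y → M x y * N y z) ⟩
    sum (λ y → sum (λ z → M x y * N y z)) ≡⟨ sum-cong-≗ (λ y → *-distribˡ-sum (M x y) (N y)) ⟨
    (M · rowSum N) x                      ∎
    where open ≡-Reasoning

  rowSum-⊠-≤ : ∀ {n} (M N : Matrix n) {x h} → (∀ y → M x y ≤ h) → rowSum (M ⊠ N) x ≤ h * total N
  rowSum-⊠-≤ M N {x} {h} Mx≤h = begin
    rowSum (M ⊠ N) x             ≡⟨ rowSum-⊠ M N x ⟩
    (M · rowSum N) x             ≤⟨ sum-mono-≤ (λ y → *-monoˡ-≤ (rowSum N y) (Mx≤h y)) ⟩
    sum (λ y → h * rowSum N y)   ≡⟨ *-distribˡ-sum h (rowSum N) ⟨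
    h * total N                  ∎
    where open ≤-Reasoning

  rowSum-⊠-≥ : ∀ {n} (M N : Matrix n) {x} → (∀ y → 0 < M x y) → total N ≤ rowSum (M ⊠ N) x
  rowSum-⊠-≥ M N {x} Mx-positive = begin
    total N            ≤⟨ sum-mono-≤ (λ y → m≤n*m (rowSum N y) (M x y) {{>-nonZero (Mx-positive y)}}) ⟩
    (M · rowSum N) x   ≡⟨ rowSum-⊠ M N x ⟨
    rowSum (M ⊠ N) x   ∎
    where open ≤-Reasoning

  entry≤total : ∀ {n} (M : Matrix n) x y → M x y ≤ total M
  entry≤total M x y = ≤-trans (≤-sum (M x) y) (≤-sum (rowSum M) x)

  ≤-⊠ : ∀ {n} (M N : Matrix n) x y z → M x y * N y z ≤ (M ⊠ N) x z
  ≤-⊠ M N x y z = ≤-sum (λ y → M x y * N y z) y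

  ⊠-congˡ : ∀ {n} (M : Matrix n) {N N′ : Matrix n} → N ≗ᴹ N′ → M ⊠ N ≗ᴹ M ⊠ N′
  ⊠-congˡ M N≗N′ x z = sum-cong-≗ (λ y → cong (M x y *_) (N≗N′ y z))

  ⊠-mono : ∀ {n} {M M′ N N′ : Matrix n} → M ≤ᴹ M′ → N ≤ᴹ N′ → M ⊠ N ≤ᴹ M′ ⊠ N′
  ⊠-mono M≤M′ N≤N′ x z = ·-mono M≤M′ (λ y → N≤N′ y z) x

  I-⊠ : ∀ {n} (M : Matrix n) → I ⊠ M ≗ᴹ M
  I-⊠ M x z = ·-I (λ y → M y z) x

  ⊠-assoc : ∀ {n} (M N O : Matrix n) → (M ⊠ N) ⊠ O ≗ᴹ M ⊠ (N ⊠ O)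
  ⊠-assoc M N O x z = begin
    sum (λ y → sum (λ w → M x w * N w y) * O y z)
      ≡⟨ sum-cong-≗ (λ y → *-distribʳ-sum (O y z) (λ w → M x w * N w y)) ⟩
    sum (λ y → sum (λ w → M x w * N w y * O y z))
      ≡⟨ ∑-comm (λ y w → M x w * N w y * O y z) ⟩
    sum (λ w → sum (λ y → M x w * N w y * O y z))
      ≡⟨ sum-cong-≗ (λ w → sum-cong-≗ (λ y → *-assoc (M x w) (N w y) (O y z))) ⟩
    sum (λ w → sum (λ y → M x w * (N w y * O y z)))
      ≡⟨ sum-cong-≗ (λ w → *-distribˡ-sum (M x w) (λ y → N w y * O y z)) ⟨
    (M ⊠ (N ⊠ O)) x z
      ∎
    where open ≡-Reasoning

  ^ᴹ-+ : ∀ {n} (M : Matrix n) a b → M ^ᴹ (a + b) ≗ᴹ M ^ᴹ a ⊠ M ^ᴹ b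
  ^ᴹ-+ M zero    b x z = sym (I-⊠ (M ^ᴹ b) x z)
  ^ᴹ-+ M (suc a) b x z = trans (⊠-congˡ M (^ᴹ-+ M a b) x z) (sym (⊠-assoc M (M ^ᴹ a) (M ^ᴹ b) x z))

  ^ᴹ-* : ∀ {n} (M : Matrix n) j K → M ^ᴹ (j * K) ≗ᴹ (M ^ᴹ K) ^ᴹ j
  ^ᴹ-* M zero    K x z = refl
  ^ᴹ-* M (suc j) K x z = trans (^ᴹ-+ M K (j * K) x z) (⊠-congˡ (M ^ᴹ K) (^ᴹ-* M j K) x z)

  ^ᴹ-mono : ∀ {n} {M N : Matrix n} → M ≤ᴹ N → ∀ k → M ^ᴹ k ≤ᴹ N ^ᴹ k
  ^ᴹ-mono M≤N zero    x y = ≤-refl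
  ^ᴹ-mono M≤N (suc k) = ⊠-mono M≤N (^ᴹ-mono M≤N k)

  ⊠-mono-<ˡ : ∀ {n} {M M′ N N′ : Matrix n} → M ≤ᴹ M′ → N ≤ᴹ N′ →
              ∀ {x y z} → M x y < M′ x y → 0 < N′ y z → (M ⊠ N) x z < (M′ ⊠ N′) x z
  ⊠-mono-<ˡ M≤M′ N≤N′ {x} {y} {z} Mxy<M′xy 0<N′yz =
    sum-mono-< (λ w → *-mono-≤ (M≤M′ x w) (N≤N′ w z)) y (*-mono-<-≤ Mxy<M′xy (N≤N′ y z) 0<N′yz)

  ⊠-mono-<ʳ : ∀ {n} {M M′ N N′ : Matrix n} → M ≤ᴹ M′ → N ≤ᴹ N′ →
              ∀ {x y z} → 0 < M′ x y → N y z < N′ y z → (M ⊠ N) x z < (M′ ⊠ N′) x z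
  ⊠-mono-<ʳ M≤M′ N≤N′ {x} {y} {z} 0<M′xy Nyz<N′yz =
    sum-mono-< (λ w → *-mono-≤ (M≤M′ x w) (N≤N′ w z)) y (*-mono-≤-< (M≤M′ x y) Nyz<N′yz 0<M′xy)

  ^ᴹ-diag-positive : ∀ {n} {M : Matrix n} → (∀ x → 0 < M x x) → ∀ k x → 0 < (M ^ᴹ k) x x
  ^ᴹ-diag-positive M-diag zero    x = ≤-reflexive (sym (I-diag x))
  ^ᴹ-diag-positive {M = M} M-diag (suc k) x =
    ≤-trans (*-mono-≤ (M-diag x) (^ᴹ-diag-positive M-diag k x)) (≤-⊠ M (M ^ᴹ k) x x x)

  ^ᴹ-positive-+ : ∀ {n} {M : Matrix n} → (∀ x → 0 < M x x) →
                  ∀ {ℓ x y} → 0 < (M ^ᴹ ℓ) x y → ∀ t → 0 < (M ^ᴹ (t + ℓ)) x y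
  ^ᴹ-positive-+ {M = M} M-diag {ℓ} {x} {y} positive t = subst (0 <_) (sym (^ᴹ-+ M t ℓ x y))
    (≤-trans (*-mono-≤ (^ᴹ-diag-positive M-diag t x) positive) (≤-⊠ (M ^ᴹ t) (M ^ᴹ ℓ) x x y))

  -- L + suc L is the length of a walk x ⇝ a → b ⇝ z through the strict entry.
  ^ᴹ-mono-< : ∀ {n} {R P : Matrix n} → R ≤ᴹ P → ∀ {a b} → R a b < P a b →
              ∀ {L} → (∀ x y → 0 < (P ^ᴹ L) x y) →
              ∀ x z → (R ^ᴹ (L + suc L)) x z < (P ^ᴹ (L + suc L)) x z
  ^ᴹ-mono-< {R = R} {P} R≤P {a} {b} Rab<Pab {L} P^L-positive x z =
    subst₂ _<_ (sym (^ᴹ-+ R L (suc L) x z)) (sym (^ᴹ-+ P L (suc L) x z))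
      (⊠-mono-<ʳ (^ᴹ-mono R≤P L) (⊠-mono R≤P (^ᴹ-mono R≤P L)) (P^L-positive x a)
        (⊠-mono-<ˡ R≤P (^ᴹ-mono R≤P L) Rab<Pab (P^L-positive b z)))

  *-total : ∀ {n} α (M : Matrix n) → α * total M ≡ sum (λ x → sum (λ y → α * M x y))
  *-total α M = trans (*-distribˡ-sum α (rowSum M)) (sum-cong-≗ (λ x → *-distribˡ-sum α (M x)))

  ⊙-total-mono : ∀ {n} {α β} {M N : Matrix n} → α ⊙ M ≤ᴹ β ⊙ N → α * total M ≤ β * total N
  ⊙-total-mono {α = α} {β} {M} {N} αM≤βN = subst₂ _≤_ (sym (*-total α M)) (sym (*-total β N))
    (sum-mono-≤ (λ x → sum-mono-≤ (αM≤βN x)))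

  ⊙-⊠-mono : ∀ {n} {α β γ δ} {M M′ N N′ : Matrix n} →
             α ⊙ M ≤ᴹ β ⊙ M′ → γ ⊙ N ≤ᴹ δ ⊙ N′ → (α * γ) ⊙ (M ⊠ N) ≤ᴹ (β * δ) ⊙ (M′ ⊠ N′)
  ⊙-⊠-mono {α = α} {β} {γ} {δ} {M} {M′} {N} {N′} αM≤βM′ γN≤δN′ x z = begin
    α * γ * (M ⊠ N) x z
      ≡⟨ scale α γ M N ⟩
    sum (λ y → (α * M x y) * (γ * N y z))
      ≤⟨ sum-mono-≤ (λ y → *-mono-≤ (αM≤βM′ x y) (γN≤δN′ y z)) ⟩
    sum (λ y → (β * M′ x y) * (δ * N′ y z))
      ≡⟨ scale β δ M′ N′ ⟨
    β * δ * (M′ ⊠ N′) x z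
      ∎
    where
    open ≤-Reasoning
    scale : ∀ a b (A B : Matrix _) → a * b * (A ⊠ B) x z ≡ sum (λ y → (a * A x y) * (b * B y z))
    scale a b A B = trans (*-distribˡ-sum (a * b) (λ y → A x y * B y z))
      (sum-cong-≗ (λ y → *-CS.interchange a b (A x y) (B y z)))

  ⊙-^ᴹ-mono : ∀ {n} {α β} {M N : Matrix n} → α ⊙ M ≤ᴹ β ⊙ N →
              ∀ j → (α ^ j) ⊙ (M ^ᴹ j) ≤ᴹ (β ^ j) ⊙ (N ^ᴹ j)
  ⊙-^ᴹ-mono αM≤βN zero    x y = ≤-refl
  ⊙-^ᴹ-mono {α = α} {β} {M} {N} αM≤βN (suc j) =
    ⊙-⊠-mono {α = α} {β} {α ^ j} {β ^ j} {M} {N} αM≤βN (⊙-^ᴹ-mono {α = α} {β} {M} {N} αM≤βN j)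

  -- Separating walk counts

  -- Every entry of T is below c, so (c + 1)·T ≤ c·S entrywise and (c + 1)ʲ·total Tʲ ≤ cʲ·total Sʲ;
  -- Bernoulli gives (1 + 1/c)ʲ ≥ 2c + 1 for j = 2c². One more factor turns totals into bounds on
  -- every row, as T ≤ c and S ≥ 1 entrywise.
  rowSum-^ᴹ-gap : ∀ {n} {T S : Matrix n} → (∀ x y → T x y < S x y) →
                  ∃₂ λ j A → (∀ x → rowSum (T ^ᴹ suc j) x ≤ A)
                           × (∀ x → 2 * A < rowSum (S ^ᴹ suc j) x)
  rowSum-^ᴹ-gap {T = T} {S} T<S = j , c * total (T ^ᴹ j) , T-rows , S-rows
    where
    c j : ℕ
    c = suc (total T)
    j = c * (2 * c)
    T≤c : ∀ x y → T x y ≤ c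
    T≤c x y = m≤n⇒m≤1+n (entry≤total T x y)
    one-step : suc c ⊙ T ≤ᴹ c ⊙ S
    one-step x y = suc-*-≤-* (T<S x y) (T≤c x y)
    growth : c ^ j * suc (2 * c) ≤ suc c ^ j
    growth = *-cancelˡ-≤ c (≤-trans (≤-reflexive (rearrange c (c ^ j))) (bernoulli c j))
      where
      rearrange : ∀ c x → c * (x * suc (2 * c)) ≡ x * (c + c * (2 * c))
      rearrange = solve-∀
    totals : suc (2 * c) * total (T ^ᴹ j) ≤ total (S ^ᴹ j)
    totals = *-cancelˡ-≤ (c ^ j) {{m^n≢0 c j}} (begin
      c ^ j * (suc (2 * c) * total (T ^ᴹ j))   ≡⟨ *-assoc (c ^ j) _ _ ⟨
      c ^ j * suc (2 * c) * total (T ^ᴹ j)     ≤⟨ *-monoˡ-≤ (total (T ^ᴹ j)) growth ⟩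
      suc c ^ j * total (T ^ᴹ j)               ≤⟨ ⊙-total-mono {α = suc c ^ j} {c ^ j} {T ^ᴹ j} {S ^ᴹ j} j-steps ⟩
      c ^ j * total (S ^ᴹ j)                   ∎)
      where
      open ≤-Reasoning
      j-steps : (suc c ^ j) ⊙ (T ^ᴹ j) ≤ᴹ (c ^ j) ⊙ (S ^ᴹ j)
      j-steps = ⊙-^ᴹ-mono {α = suc c} {c} {T} {S} one-step j
    S-positive : ∀ x y → 0 < S x y
    S-positive x y = ≤-<-trans z≤n (T<S x y)
    T-rows : ∀ x → rowSum (T ^ᴹ suc j) x ≤ c * total (T ^ᴹ j)
    T-rows x = rowSum-⊠-≤ T (T ^ᴹ j) (T≤c x)
    S-rows : ∀ x → 2 * (c * total (T ^ᴹ j)) < rowSum (S ^ᴹ suc j) x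
    S-rows x = suc-2*-*-≤ c (total (T ^ᴹ j))
      (≤-trans (^ᴹ-diag-positive {M = S} (λ y → S-positive y y) (suc j) x) (≤-sum ((S ^ᴹ suc j) x) x))
      (≤-trans totals (rowSum-⊠-≥ S (S ^ᴹ j) (S-positive x)))

  walk-count-gap : ∀ {n} {R P : Matrix n} → R ≤ᴹ P → ∀ {a b} → R a b < P a b →
                   ∀ {L} → (∀ x y → 0 < (P ^ᴹ L) x y) →
                   ∃₂ λ N A → 0 < N × (∀ x → rowSum (R ^ᴹ N) x ≤ A)
                                    × (∀ x → 2 * A < rowSum (P ^ᴹ N) x)
  walk-count-gap {R = R} {P} R≤P Rab<Pab {L} P^L-positive =
    regroup (rowSum-^ᴹ-gap (^ᴹ-mono-< R≤P Rab<Pab {L} P^L-positive))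
    where
    K = L + suc L
    regroup : (∃₂ λ j A → (∀ x → rowSum ((R ^ᴹ K) ^ᴹ suc j) x ≤ A)
                        × (∀ x → 2 * A < rowSum ((P ^ᴹ K) ^ᴹ suc j) x)) →
              ∃₂ λ N A → 0 < N × (∀ x → rowSum (R ^ᴹ N) x ≤ A)
                               × (∀ x → 2 * A < rowSum (P ^ᴹ N) x)
    regroup (j , A , T-rows , S-rows) =
        suc j * K , A
      , ≤-trans (≤-trans (s≤s z≤n) (m≤n+m (suc L) L)) (m≤m+n K (j * K))
      , (λ x → ≤-trans (≤-reflexive (rowSum-cong (^ᴹ-* R (suc j) K) x)) (T-rows x))
      , (λ x → <-≤-trans (S-rows x) (≤-reflexive (sym (rowSum-cong (^ᴹ-* P (suc j) K) x))))

  -- Truncated Neumann series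

  -- neumann M p D k = Σ_{i<k} p^(k−1−i)·Dⁱ·Mⁱ1 = p^(k−1)·Σ_{i<k} q⁻ⁱ·Mⁱ1 for q = p/D.
  neumann : ∀ {n} → Matrix n → (p D : ℕ) → ℕ → Fin n → ℕ
  neumann M p D zero    v = 0
  neumann M p D (suc k) v = p * neumann M p D k v + D ^ k * rowSum (M ^ᴹ k) v

  neumann-identity : ∀ {n} (M : Matrix n) p D k v →
                     D * (M · neumann M p D k) v + p ^ k ≡ p * neumann M p D k v + D ^ k * rowSum (M ^ᴹ k) v
  neumann-identity M p D zero v = begin
    D * (M · λ _ → 0) v + 1   ≡⟨ cong (λ s → D * s + 1) (·-zeroʳ M v) ⟩
    D * 0 + 1                 ≡⟨ cong (_+ 1) (*-zeroʳ D) ⟩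
    1                         ≡⟨ trans (*-identityˡ (rowSum I v)) (rowSum-I v) ⟨
    1 * rowSum I v            ≡⟨ cong (_+ 1 * rowSum I v) (*-zeroʳ p) ⟨
    p * 0 + 1 * rowSum I v    ∎
    where open ≡-Reasoning
  neumann-identity M p D (suc k) v = begin
    D * (M · X (suc k)) v + p * p ^ k
      ≡⟨ cong (λ s → D * s + p * p ^ k) (·-linear M p (X k) (D ^ k) (rowSum (M ^ᴹ k)) v) ⟩
    D * (p * (M · X k) v + D ^ k * (M · rowSum (M ^ᴹ k)) v) + p * p ^ k
      ≡⟨ cong (λ s → D * (p * (M · X k) v + D ^ k * s) + p * p ^ k) (rowSum-⊠ M (M ^ᴹ k) v) ⟨
    D * (p * (M · X k) v + D ^ k * r′) + p * p ^ k
      ≡⟨ regroup D p ((M · X k) v) (D ^ k) r′ (p ^ k) ⟩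
    p * (D * (M · X k) v + p ^ k) + D * D ^ k * r′
      ≡⟨ cong (λ s → p * s + D * D ^ k * r′) (neumann-identity M p D k v) ⟩
    p * X (suc k) v + D ^ suc k * r′
      ∎
    where
    open ≡-Reasoning
    X = neumann M p D
    r′ = rowSum (M ^ᴹ suc k) v
    regroup : ∀ D p a x r q → D * (p * a + x * r) + p * q ≡ p * (D * a + q) + D * x * r
    regroup = solve-∀

  neumann-< : ∀ {n} (M : Matrix n) p D N → (∀ v → D ^ N * rowSum (M ^ᴹ N) v < p ^ N) →
              ∀ v → D * (M · neumann M p D N) v < p * neumann M p D N v
  neumann-< M p D N few-walks v = +-cancelʳ-< (p ^ N) _ _
    (subst (_< p * neumann M p D N v + p ^ N) (sym (neumann-identity M p D N v))
      (+-monoʳ-< (p * neumann M p D N v) (few-walks v)))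

  neumann-≥ : ∀ {n} (M : Matrix n) p D N → (∀ v → p ^ N ≤ D ^ N * rowSum (M ^ᴹ N) v) →
              ∀ v → p * neumann M p D N v ≤ D * (M · neumann M p D N) v
  neumann-≥ M p D N many-walks v = +-cancelʳ-≤ (p ^ N) _ _
    (subst (p * neumann M p D N v + p ^ N ≤_) (sym (neumann-identity M p D N v))
      (+-monoʳ-≤ (p * neumann M p D N v) (many-walks v)))

  neumann-positive : ∀ {n} (M : Matrix n) {p} D → 0 < p → ∀ k v → 0 < neumann M p D (suc k) v
  neumann-positive M {p} D 0<p zero    v =
    ≤-trans (≤-reflexive (sym (trans (*-identityˡ (rowSum I v)) (rowSum-I v)))) (m≤n+m _ (p * 0))
  neumann-positive M {p} D 0<p (suc k) v =
    ≤-trans (*-mono-≤ 0<p (neumann-positive M D 0<p k v)) (m≤m+n (p * neumann M p D (suc k) v) _)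

  -- Transport along an injection

  pushforward : ∀ {k n} → (Fin k → Fin n) → Matrix k → Matrix n
  pushforward f M x y with Finₚ.any? (λ u → f u Finₚ.≟ x) | Finₚ.any? (λ v → f v Finₚ.≟ y)
  ... | yes (u , _) | yes (v , _) = M u v
  ... | _           | _           = 0

  pushforward-outside : ∀ {k n} {f : Fin k → Fin n} (M : Matrix k) {x} → (∀ u → f u ≢ x) →
                        ∀ y → pushforward f M x y ≡ 0
  pushforward-outside {f = f} M {x} x∉f y with Finₚ.any? (λ u → f u Finₚ.≟ x)
  ... | yes (u , fu≡x) = contradiction fu≡x (x∉f u)
  ... | no _           = refl

  pushforward-≤ : ∀ {k n} {f : Fin k → Fin n} {M : Matrix k} {P : Matrix n} →
                  (∀ u v → M u v ≤ P (f u) (f v)) → pushforward f M ≤ᴹ P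
  pushforward-≤ {f = f} M≤P x y
    with Finₚ.any? (λ u → f u Finₚ.≟ x) | Finₚ.any? (λ v → f v Finₚ.≟ y)
  ... | yes (u , refl) | yes (v , refl) = M≤P u v
  ... | yes _          | no _           = z≤n
  ... | no _           | _              = z≤n

  module _ {k n} {f : Fin k → Fin n} (f-inj : Injective _≡_ _≡_ f) (M : Matrix k) where

    pushforward-image : ∀ u v → pushforward f M (f u) (f v) ≡ M u v
    pushforward-image u v
      with Finₚ.any? (λ u′ → f u′ Finₚ.≟ f u) | Finₚ.any? (λ v′ → f v′ Finₚ.≟ f v)
    ... | yes (u′ , fu′≡fu) | yes (v′ , fv′≡fv) = cong₂ M (f-inj fu′≡fu) (f-inj fv′≡fv)
    ... | no ∄u′            | _                  = contradiction (u , refl) ∄u′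
    ... | yes _             | no ∄v′             = contradiction (v , refl) ∄v′

    rowSum-pushforward : ∀ N u → rowSum (M ^ᴹ N) u ≤ rowSum (pushforward f M ^ᴹ N) (f u)
    rowSum-pushforward zero    u = ≤-reflexive (trans (rowSum-I u) (sym (rowSum-I (f u))))
    rowSum-pushforward (suc N) u = begin
      rowSum (M ^ᴹ suc N) u
        ≡⟨ rowSum-⊠ M (M ^ᴹ N) u ⟩
      sum (λ v → M u v * rowSum (M ^ᴹ N) v)
        ≤⟨ sum-mono-≤ (λ v → *-mono-≤ (≤-reflexive (sym (pushforward-image u v)))
                                      (rowSum-pushforward N v)) ⟩
      sum (λ v → R (f u) (f v) * rowSum (R ^ᴹ N) (f v))
        ≤⟨ sum-∘-injective-≤ (λ y → R (f u) y * rowSum (R ^ᴹ N) y) f-inj ⟩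
      (R · rowSum (R ^ᴹ N)) (f u)
        ≡⟨ rowSum-⊠ R (R ^ᴹ N) (f u) ⟨
      rowSum (R ^ᴹ suc N) (f u)
        ∎
      where
      open ≤-Reasoning
      R = pushforward f M

  ballMatrix : ∀ {n} → Graph n → Matrix n
  ballMatrix G x y = I x y + (if adj G x y then 1 else 0)

  ballMatrix-· : ∀ {n} (G : Graph n) (X : Fin n → ℕ) v →
                 (ballMatrix G · X) v ≡ X v + sum (λ w → if adj G v w then X w else 0)
  ballMatrix-· G X v = begin
    sum (λ w → (I v w + A w) * X w)
      ≡⟨ sum-cong-≗ (λ w → *-distribʳ-+ (X w) (I v w) (A w)) ⟩
    sum (λ w → I v w * X w + A w * X w)
      ≡⟨ ∑-distrib-+ (λ w → I v w * X w) (λ w → A w * X w) ⟩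
    (I · X) v + sum (λ w → A w * X w)
      ≡⟨ cong₂ _+_ (·-I X v) (sum-cong-≗ (λ w → select (adj G v w) (X w))) ⟩
    X v + sum (λ w → if adj G v w then X w else 0)
      ∎
    where
    open ≡-Reasoning
    A = λ w → if adj G v w then 1 else 0
    select : ∀ b x → (if b then 1 else 0) * x ≡ (if b then x else 0)
    select true  x = +-identityʳ x
    select false x = refl

  ballMatrix-diag : ∀ {n} (G : Graph n) x → 0 < ballMatrix G x x
  ballMatrix-diag G x = ≤-trans (≤-reflexive (sym (I-diag x))) (m≤m+n (I x x) _)

  ballMatrix-edge : ∀ {n} (G : Graph n) {x y} → adj G x y ≡ true → 0 < ballMatrix G x y
  ballMatrix-edge G {x} {y} xy rewrite xy = m≤n+m 1 (I x y)

  ballMatrix-non-edge : ∀ {n} (G : Graph n) {x y} → x ≢ y → adj G x y ≡ false → ballMatrix G x y ≡ 0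
  ballMatrix-non-edge G x≢y xy rewrite xy | I-≢ x≢y = refl

  ballMatrix-subgraph : ∀ {k n} (G₁ : Graph k) (G₂ : Graph n) {f : Fin k → Fin n} →
                        (∀ u v → adj G₁ u v ≡ true → adj G₂ (f u) (f v) ≡ true) →
                        ∀ u v → ballMatrix G₁ u v ≤ ballMatrix G₂ (f u) (f v)
  ballMatrix-subgraph G₁ G₂ {f} edges u v = +-mono-≤ (I-≤-map f u v) adjacency
    where
    adjacency : (if adj G₁ u v then 1 else 0) ≤ (if adj G₂ (f u) (f v) then 1 else 0)
    adjacency with adj G₁ u v in uv
    ... | true rewrite edges u v uv = ≤-refl
    ... | false = z≤n

  walk⇒positive : ∀ {n} (G : Graph n) {x y} → Reach G x y → ∃ λ ℓ → 0 < (ballMatrix G ^ᴹ ℓ) x y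
  walk⇒positive G {x} here = 0 , ≤-reflexive (sym (I-diag x))
  walk⇒positive G {x} {y} (step {w = w} xw w⇝y) =
    let ℓ , positive = walk⇒positive G w⇝y
    in suc ℓ , ≤-trans (*-mono-≤ (ballMatrix-edge G xw) positive) (≤-⊠ B (B ^ᴹ ℓ) x w y)
    where B = ballMatrix G

  connected⇒positive-power : ∀ {n} (G : Graph n) → Connected G →
                             ∃ λ L → ∀ x y → 0 < (ballMatrix G ^ᴹ L) x y
  connected⇒positive-power G connected = total ℓ , positive
    where
    ℓ : Matrix _
    ℓ x y = proj₁ (walk⇒positive G (connected x y))
    positive : ∀ x y → 0 < (ballMatrix G ^ᴹ total ℓ) x y
    positive x y = subst (λ L → 0 < (ballMatrix G ^ᴹ L) x y) (m∸n+n≡m (entry≤total ℓ x y))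
      (^ᴹ-positive-+ (ballMatrix-diag G) (proj₂ (walk⇒positive G (connected x y))) (total ℓ ∸ ℓ x y))

  proper⇒strict-entry : ∀ {k n} (G₁ : Graph k) (G₂ : Graph n) {f : Fin k → Fin n} →
                        Injective _≡_ _≡_ f → IsProper G₁ G₂ f →
                        ∃₂ λ a b → pushforward f (ballMatrix G₁) a b < ballMatrix G₂ a b
  proper⇒strict-entry G₁ G₂ _ (inj₁ (w , w∉f)) =
    w , w , subst (_< ballMatrix G₂ w w) (sym (pushforward-outside _ w∉f w)) (ballMatrix-diag G₂ w)
  proper⇒strict-entry G₁ G₂ {f} f-inj (inj₂ (u , v , fu-fv , ¬u-v)) =
    f u , f v , subst (_< ballMatrix G₂ (f u) (f v)) (sym B₁uv≡0) (ballMatrix-edge G₂ fu-fv)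
    where
    u≢v : u ≢ v
    u≢v refl with trans (sym fu-fv) (irrefl G₂ (f u))
    ... | ()
    B₁uv≡0 : pushforward f (ballMatrix G₁) (f u) (f v) ≡ 0
    B₁uv≡0 = trans (pushforward-image f-inj (ballMatrix G₁) u v) (ballMatrix-non-edge G₁ u≢v ¬u-v)

module _ where
  open import Algebra.Bundles using (Ring)
  import Algebra.Properties.Semiring.Sum as SemiringSum
  import Data.Nat as ℕ
  import Data.Nat.Properties as ℕ
  open import Data.Rational using (ℚ; 0ℚ; 1ℚ; _+_; _*_; _÷_; 1/_; _<_; _≤_; Positive; positive; nonNegative)
  open import Data.Rational.Properties
  open import Data.Rational.Solver using (module +-*-Solver)
  open import Algebra.Properties.Semiring.Sum (Ring.semiring +-*-ring)
    using (sum; sum-cong-≗; ∑-distrib-+; ∑-comm; *-distribˡ-sum)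
  open import Algebra.Properties.Semiring.Mult (Ring.semiring +-*-ring)
    using (×-homo-+; ×1-homo-*) renaming (_×_ to _×ℚ_)

  private
    module ℕΣ = SemiringSum ℕ.+-*-semiring

    sum-mono-≤ : ∀ {n} {f g : Fin n → ℚ} → (∀ i → f i ≤ g i) → sum f ≤ sum g
    sum-mono-≤ {ℕ.zero}  f≤g = ≤-refl
    sum-mono-≤ {ℕ.suc n} f≤g = +-mono-≤ (f≤g zero) (sum-mono-≤ (f≤g ∘ suc))

    sum-mono-< : ∀ {n} {f g : Fin n → ℚ} → Fin n → (∀ i → f i < g i) → sum f < sum g
    sum-mono-< {ℕ.suc n} _ f<g = +-mono-<-≤ (f<g zero) (sum-mono-≤ (<⇒≤ ∘ f<g ∘ suc))

  toℚ : ℕ → ℚ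
  toℚ n = n ×ℚ 1ℚ

  toℚ-+ : ∀ m n → toℚ (m ℕ.+ n) ≡ toℚ m + toℚ n
  toℚ-+ = ×-homo-+ 1ℚ

  toℚ-* : ∀ m n → toℚ (m ℕ.* n) ≡ toℚ m * toℚ n
  toℚ-* = ×1-homo-*

  toℚ-sum : ∀ {n} (f : Fin n → ℕ) → toℚ (ℕΣ.sum f) ≡ sum (toℚ ∘ f)
  toℚ-sum {ℕ.zero}  f = refl
  toℚ-sum {ℕ.suc n} f = trans (toℚ-+ (f zero) _) (cong (toℚ (f zero) +_) (toℚ-sum (f ∘ suc)))

  toℚ-nonNeg : ∀ n → 0ℚ ≤ toℚ n
  toℚ-nonNeg ℕ.zero    = ≤-refl
  toℚ-nonNeg (ℕ.suc n) =
    subst (_≤ toℚ (ℕ.suc n)) (+-identityˡ 0ℚ) (+-mono-≤ (<⇒≤ (positive⁻¹ 1ℚ)) (toℚ-nonNeg n))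

  toℚ-<-suc : ∀ n → toℚ n < toℚ (ℕ.suc n)
  toℚ-<-suc n = subst (_< toℚ (ℕ.suc n)) (+-identityˡ (toℚ n)) (+-monoˡ-< (toℚ n) (positive⁻¹ 1ℚ))

  toℚ-mono-≤ : ∀ {m n} → m ℕ.≤ n → toℚ m ≤ toℚ n
  toℚ-mono-≤ {m} {n} m≤n = begin
    toℚ m                    ≡⟨ +-identityʳ (toℚ m) ⟨
    toℚ m + 0ℚ               ≤⟨ +-monoʳ-≤ (toℚ m) (toℚ-nonNeg (n ℕ.∸ m)) ⟩
    toℚ m + toℚ (n ℕ.∸ m)    ≡⟨ toℚ-+ m (n ℕ.∸ m) ⟨
    toℚ (m ℕ.+ (n ℕ.∸ m))    ≡⟨ cong toℚ (ℕ.m+[n∸m]≡n m≤n) ⟩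
    toℚ n                    ∎
    where open ≤-Reasoning

  toℚ-mono-< : ∀ {m n} → m ℕ.< n → toℚ m < toℚ n
  toℚ-mono-< {m} m<n = <-≤-trans (toℚ-<-suc m) (toℚ-mono-≤ m<n)

  toℚ-positive : ∀ D .{{_ : ℕ.NonZero D}} → Positive (toℚ D)
  toℚ-positive D = positive (toℚ-mono-< (ℕ.>-nonZero⁻¹ D))

  infixl 7 _/ℕ_

  _/ℕ_ : ℕ → (D : ℕ) → .{{ℕ.NonZero D}} → ℚ
  p /ℕ D = (toℚ p ÷ toℚ D) {{pos⇒nonZero (toℚ D) {{toℚ-positive D}}}}

  *-/ℕ : ∀ p D .{{_ : ℕ.NonZero D}} y → toℚ D * (p /ℕ D * y) ≡ toℚ p * y
  *-/ℕ p D y = begin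
    toℚ D * (toℚ p * i * y)   ≡⟨ regroup (toℚ D) (toℚ p) i y ⟩
    toℚ D * i * (toℚ p * y)   ≡⟨ cong (_* (toℚ p * y)) (*-inverseʳ (toℚ D) {{nonZero}}) ⟩
    1ℚ * (toℚ p * y)          ≡⟨ *-identityˡ (toℚ p * y) ⟩
    toℚ p * y                 ∎
    where
    open ≡-Reasoning
    nonZero = pos⇒nonZero (toℚ D) {{toℚ-positive D}}
    i = (1/ toℚ D) {{nonZero}}
    regroup : ∀ a b c y → a * (b * c * y) ≡ a * c * (b * y)
    regroup = +-*-Solver.solve 4 (λ a b c y → a :* (b :* c :* y) := a :* c :* (b :* y)) refl
      where open +-*-Solver

  toℚ-<-/ℕ : ∀ {p D} .{{_ : ℕ.NonZero D}} {a x} → D ℕ.* a ℕ.< p ℕ.* x → toℚ a < p /ℕ D * toℚ x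
  toℚ-<-/ℕ {p} {D} {a} {x} Da<px = *-cancelˡ-<-nonNeg (toℚ D) {{nonNegative (toℚ-nonNeg D)}}
    (subst₂ _<_ (toℚ-* D a) (trans (toℚ-* p x) (sym (*-/ℕ p D (toℚ x)))) (toℚ-mono-< Da<px))

  /ℕ-≤-toℚ : ∀ {p D} .{{_ : ℕ.NonZero D}} {a x} → p ℕ.* x ℕ.≤ D ℕ.* a → p /ℕ D * toℚ x ≤ toℚ a
  /ℕ-≤-toℚ {p} {D} {a} {x} px≤Da = *-cancelˡ-≤-pos (toℚ D) {{toℚ-positive D}}
    (subst₂ _≤_ (trans (toℚ-* p x) (sym (*-/ℕ p D (toℚ x)))) (toℚ-* D a) (toℚ-mono-≤ px≤Da))

  neighbourSum : ∀ {n} → Graph n → (Fin n → ℚ) → Fin n → ℚ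
  neighbourSum G μ v = sum (λ w → if adj G v w then μ w else 0ℚ)

  ballMass-neighbourSum : ∀ {n} (G : Graph n) μ v → ballMass G μ v ≡ μ v + neighbourSum G μ v
  ballMass-neighbourSum {n} G μ v = cong (μ v +_) (sumFin≡sum n (λ w → if adj G v w then μ w else 0ℚ))
    where
    sumFin≡sum : ∀ n (f : Fin n → ℚ) → sumFin n f ≡ sum f
    sumFin≡sum ℕ.zero    f = refl
    sumFin≡sum (ℕ.suc n) f = cong (f zero +_) (sumFin≡sum n (f ∘ suc))

  ballMass-toℚ : ∀ {n} (G : Graph n) (X : Fin n → ℕ) v →
                 ballMass G (toℚ ∘ X) v ≡ toℚ ((ballMatrix G · X) v)
  ballMass-toℚ G X v = begin
    ballMass G (toℚ ∘ X) v                   ≡⟨ ballMass-neighbourSum G (toℚ ∘ X) v ⟩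
    toℚ (X v) + neighbourSum G (toℚ ∘ X) v   ≡⟨ cong (toℚ (X v) +_) (sum-cong-≗ (λ w → toℚ-if (adj G v w) w)) ⟨
    toℚ (X v) + sum (toℚ ∘ A)                ≡⟨ cong (toℚ (X v) +_) (toℚ-sum A) ⟨
    toℚ (X v) + toℚ (ℕΣ.sum A)               ≡⟨ toℚ-+ (X v) (ℕΣ.sum A) ⟨
    toℚ (X v ℕ.+ ℕΣ.sum A)                   ≡⟨ cong toℚ (ballMatrix-· G X v) ⟨
    toℚ ((ballMatrix G · X) v)               ∎
    where
    open ≡-Reasoning
    A = λ w → if adj G v w then X w else 0
    toℚ-if : ∀ b w → toℚ (if b then X w else 0) ≡ (if b then toℚ (X w) else 0ℚ)
    toℚ-if true  w = refl
    toℚ-if false w = refl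

  neighbourSum-selfAdjoint : ∀ {n} (G : Graph n) (ξ μ : Fin n → ℚ) →
                             sum (λ v → ξ v * neighbourSum G μ v) ≡ sum (λ v → μ v * neighbourSum G ξ v)
  neighbourSum-selfAdjoint G ξ μ = begin
    sum (λ v → ξ v * neighbourSum G μ v)
      ≡⟨ sum-cong-≗ (λ v → *-distribˡ-sum (ξ v) (λ w → if adj G v w then μ w else 0ℚ)) ⟩
    sum (λ v → sum (λ w → ξ v * (if adj G v w then μ w else 0ℚ)))
      ≡⟨ ∑-comm (λ v w → ξ v * (if adj G v w then μ w else 0ℚ)) ⟩
    sum (λ w → sum (λ v → ξ v * (if adj G v w then μ w else 0ℚ)))
      ≡⟨ sum-cong-≗ (λ w → sum-cong-≗ (λ v → edge-term v w)) ⟩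
    sum (λ w → sum (λ v → μ w * (if adj G w v then ξ v else 0ℚ)))
      ≡⟨ sum-cong-≗ (λ w → *-distribˡ-sum (μ w) (λ v → if adj G w v then ξ v else 0ℚ)) ⟨
    sum (λ w → μ w * neighbourSum G ξ w)
      ∎
    where
    open ≡-Reasoning
    edge-term : ∀ v w → ξ v * (if adj G v w then μ w else 0ℚ) ≡ μ w * (if adj G w v then ξ v else 0ℚ)
    edge-term v w rewrite Graph.sym G v w with adj G w v
    ... | true  = *-comm (ξ v) (μ w)
    ... | false = trans (*-zeroʳ (ξ v)) (sym (*-zeroʳ (μ w)))

  ballMass-selfAdjoint : ∀ {n} (G : Graph n) (ξ μ : Fin n → ℚ) →
                         sum (λ v → ξ v * ballMass G μ v) ≡ sum (λ v → μ v * ballMass G ξ v)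
  ballMass-selfAdjoint G ξ μ = begin
    sum (λ v → ξ v * ballMass G μ v)
      ≡⟨ sum-cong-≗ (λ v → trans (cong (ξ v *_) (ballMass-neighbourSum G μ v))
                                  (*-distribˡ-+ (ξ v) (μ v) _)) ⟩
    sum (λ v → ξ v * μ v + ξ v * neighbourSum G μ v)
      ≡⟨ ∑-distrib-+ (λ v → ξ v * μ v) (λ v → ξ v * neighbourSum G μ v) ⟩
    sum (λ v → ξ v * μ v) + sum (λ v → ξ v * neighbourSum G μ v)
      ≡⟨ cong₂ _+_ (sum-cong-≗ (λ v → *-comm (ξ v) (μ v))) (neighbourSum-selfAdjoint G ξ μ) ⟩
    sum (λ v → μ v * ξ v) + sum (λ v → μ v * neighbourSum G ξ v)
      ≡⟨ ∑-distrib-+ (λ v → μ v * ξ v) (λ v → μ v * neighbourSum G ξ v) ⟨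
    sum (λ v → μ v * ξ v + μ v * neighbourSum G ξ v)
      ≡⟨ sum-cong-≗ (λ v → trans (cong (μ v *_) (ballMass-neighbourSum G ξ v))
                                  (*-distribˡ-+ (μ v) (ξ v) _)) ⟨
    sum (λ v → μ v * ballMass G ξ v)
      ∎
    where open ≡-Reasoning

  supersolution⇒C0-ge : ∀ {n} (G : Graph n) {q} → Fin n → (ξ : Fin n → ℚ) → (∀ v → 0ℚ < ξ v) →
                        (∀ v → q * ξ v ≤ ballMass G ξ v) → C0-ge G q
  supersolution⇒C0-ge G {q} w ξ ξ-positive ξ-super (μ , μ-positive)
    with Finₚ.any? (λ v → q * μ v ≤? ballMass G μ v)
  ... | yes found = found
  ... | no  none  = contradiction (begin-strict
    sum (λ v → μ v * (q * ξ v))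
      ≤⟨ sum-mono-≤ (λ v → *-monoˡ-≤-nonNeg (μ v) {{nonNegative (<⇒≤ (μ-positive v))}} (ξ-super v)) ⟩
    sum (λ v → μ v * ballMass G ξ v)
      ≡⟨ ballMass-selfAdjoint G ξ μ ⟨
    sum (λ v → ξ v * ballMass G μ v)
      <⟨ sum-mono-< w (λ v → *-monoʳ-<-pos (ξ v) {{positive (ξ-positive v)}} (μ-sub v)) ⟩
    sum (λ v → ξ v * (q * μ v))
      ≡⟨ sum-cong-≗ (λ v → swap (ξ v) q (μ v)) ⟩
    sum (λ v → μ v * (q * ξ v))
      ∎) (<-irrefl refl)
    where
    open ≤-Reasoning
    μ-sub : ∀ v → ballMass G μ v < q * μ v
    μ-sub v = ≰⇒> (λ le → none (v , le))
    swap : ∀ a b c → a * (b * c) ≡ c * (b * a)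
    swap = +-*-Solver.solve 3 (λ a b c → a :* (b :* c) := c :* (b :* a)) refl
      where open +-*-Solver

  few-walks⇒C0-lt : ∀ {n} (G : Graph n) {p d N} → 0 ℕ.< p → 0 ℕ.< N →
                    (∀ v → ℕ.suc d ℕ.^ N ℕ.* rowSum (ballMatrix G ^ᴹ N) v ℕ.< p ℕ.^ N) →
                    C0-lt G (p /ℕ ℕ.suc d)
  few-walks⇒C0-lt G {p} {d} {ℕ.suc N} 0<p _ few-walks =
    (toℚ ∘ X , λ v → toℚ-mono-< (neumann-positive B D 0<p N v)) ,
    λ v → subst (_< p /ℕ D * toℚ (X v)) (sym (ballMass-toℚ G X v))
            (toℚ-<-/ℕ {p} {D} {(B · X) v} (neumann-< B p D (ℕ.suc N) few-walks v))
    where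
    B = ballMatrix G
    D = ℕ.suc d
    X = neumann B p D (ℕ.suc N)

  many-walks⇒C0-ge : ∀ {n} (G : Graph n) {p d N} → Fin n → 0 ℕ.< p → 0 ℕ.< N →
                     (∀ v → p ℕ.^ N ℕ.≤ ℕ.suc d ℕ.^ N ℕ.* rowSum (ballMatrix G ^ᴹ N) v) →
                     C0-ge G (p /ℕ ℕ.suc d)
  many-walks⇒C0-ge G {p} {d} {ℕ.suc N} w 0<p _ many-walks =
    supersolution⇒C0-ge G {p /ℕ D} w (toℚ ∘ X) (λ v → toℚ-mono-< (neumann-positive B D 0<p N v))
      (λ v → subst (p /ℕ D * toℚ (X v) ≤_) (sym (ballMass-toℚ G X v))
               (/ℕ-≤-toℚ {p} {D} {(B · X) v} (neumann-≥ B p D (ℕ.suc N) many-walks v)))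
    where
    B = ballMatrix G
    D = ℕ.suc d
    X = neumann B p D (ℕ.suc N)

corollary3p3 : (m n : ℕ) (G1 : Graph (suc m)) (G2 : Graph n) (f : Fin (suc m) → Fin n)
    → Connected G1 → Connected G2 → IsSubgraph G1 G2 f → IsProper G1 G2 f
    → ∃ (λ (q : ℚ) → C0-lt G1 q × C0-ge G2 q)
corollary3p3 m n G1 G2 f _ connected₂ (f-inj , f-edges) proper =
  let L , P^L-positive        = connected⇒positive-power G2 connected₂
      a , b , Rab<Pab         = proper⇒strict-entry G1 G2 f-inj proper
      R≤P                     = pushforward-≤ (ballMatrix-subgraph G1 G2 f-edges)
      N , A , 0<N , R-rows , P-rows = walk-count-gap R≤P Rab<Pab {L} P^L-positive
      p , d , 0<p , below , above  = separating-ratio A N 0<N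
      G1-rows u = ℕₚ.≤-trans (rowSum-pushforward f-inj (ballMatrix G1) N u) (R-rows (f u))
  in p /ℕ suc d
   , few-walks⇒C0-lt G1 0<p 0<N (below ∘ G1-rows)
   , many-walks⇒C0-ge G2 (f zero) 0<p 0<N (above ∘ P-rows)
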